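{- Let $G$ be a permutation graph with $n$ vertices. Then the boolean-width of $G$ satisfies $\mathrm{boolw}(G) \le \log_2 n$.
   Context: A graph is a permutation graph if it has an intersection model consisting of straight line segments (one per vertex) between two parallel lines, two vertices being adjacent iff their segments intersect. For $A\subseteq V(G)$ write $\overline{A}=V(G)\setminus A$. A decomposition tree of $G$ is a pair $(T,\delta)$ where $T$ is a tree whose internal nodes have degree three and which has $|V(G)|$ leaves, and $\delta$ is a bijection between $V(G)$ and the leaves of $T$; each edge of $T$ defines a cut $\{A,\overline{A}\}$ of $V(G)$ given by the leaves of the two components of $T$ minus that edge. Define $\mathrm{cut\text{ - }bool}(A)=\log_2|\{S\subseteq\overline{A} : \exists X\subseteq A,\ S=\overline{A}\cap\bigcup_{x\in X}N(x)\}|$. The boolean-width of $(T,\delta)$ is the maximum of $\mathrm{cut\text{ - }bool}(A)$ over the cuts $\{A,\overline{A}\}$ given by edges of $T$, and $\mathrm{boolw}(G)$ is the minimum boolean-width over all decomposition trees of $G$. -}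

module Defs where

open import Data.Nat using (ℕ; zero; suc; _≤_)
open import Data.Bool using (Bool; true; false; _∧_; _∨_; not)
open import Data.Fin using (Fin) renaming (_<_ to _<ᶠ_)
open import Data.Fin.Subset using (Subset; inside; outside; _⊆_; _∩_; ∁)
open import Data.Fin.Subset.Properties using (_⊆?_)
open import Data.Fin.Permutation using (Permutation′; _⟨$⟩ʳ_)
open import Data.Vec using (Vec; []; _∷_; tabulate; lookup)
open import Data.Vec.Properties using (≡-dec)
open import Data.Bool.Properties using () renaming (_≟_ to _≟ᵇ_)
open import Data.List using (List; []; _∷_; _++_; map; filter; length; allFin)
open import Data.Bool.ListAction using (any)
open import Data.List.Relation.Unary.Any using (Any)
import Data.List.Relation.Unary.Any as Any
open import Data.List.Relation.Unary.All using (All)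
open import Data.List.Relation.Binary.Permutation.Propositional using (_↭_)
open import Data.Product using (Σ; _×_; _,_)
open import Data.Sum using (_⊎_)
open import Relation.Binary.PropositionalEquality using (_≡_)
open import Relation.Nullary using (Dec; _×-dec_)
open import Relation.Nullary.Decidable using (⌊_⌋)
open import Data.Fin using (_≟_)
open import Function.Bundles using (_⇔_)

record Graph (n : ℕ) : Set where
  field
    adj   : Fin n → Fin n → Bool
    sym   : ∀ u v → adj u v ≡ adj v u
    irrefl : ∀ v → adj v v ≡ false
open Graph public

-- Permutation graphs: intersection graph of segments between two
-- parallel lines.  Segment of v joins position top(v) on the upper line
-- to position bottom(v) on the lower line (positions are distinct, given
-- by permutations of Fin n).  Segments u ≠ v intersect iff the orders
-- of their endpoints on the two lines disagree.

Crossing : ∀ {n} → (Fin n → Fin n) → (Fin n → Fin n) → Fin n → Fin n → Set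
Crossing top bot u v =
  (top u <ᶠ top v × bot v <ᶠ bot u) ⊎ (top v <ᶠ top u × bot u <ᶠ bot v)

IsPermutationGraph : ∀ {n} → Graph n → Set
IsPermutationGraph {n} G =
  Σ (Permutation′ n) λ top → Σ (Permutation′ n) λ bot →
    ∀ u v → (adj G u v ≡ true) ⇔ Crossing (top ⟨$⟩ʳ_) (bot ⟨$⟩ʳ_) u v

allSubsets : (n : ℕ) → List (Subset n)
allSubsets zero = [] ∷ []
allSubsets (suc n) = map (outside ∷_) (allSubsets n) ++ map (inside ∷_) (allSubsets n)

nbhd : ∀ {n} → Graph n → Subset n → Subset n
nbhd {n} G X = tabulate λ y → any (λ x → lookup X x ∧ adj G x y) (allFin n)

Realized : ∀ {n} → Graph n → Subset n → Subset n → Set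
Realized {n} G A S = Any (λ X → X ⊆ A × S ≡ (∁ A ∩ nbhd G X)) (allSubsets n)

realized? : ∀ {n} (G : Graph n) (A S : Subset n) → Dec (Realized G A S)
realized? {n} G A S =
  Any.any? (λ X → (X ⊆? A) ×-dec ≡-dec _≟ᵇ_ S (∁ A ∩ nbhd G X)) (allSubsets n)

-- |{ S ⊆ Ā : ∃ X ⊆ A, S = Ā ∩ N(X) }|,  so cut-bool(A) = log₂ (cutBoolCount G A)
cutBoolCount : ∀ {n} → Graph n → Subset n → ℕ
cutBoolCount {n} G A = length (filter (realized? G A) (allSubsets n))

-- A tree with internal nodes of degree three and
-- leaves bijectively labelled by V(G) is represented by rooting it
-- (subdividing an edge): a full binary tree with leaves labelled by Fin n.

data BTree (n : ℕ) : Set where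
  leaf : Fin n → BTree n
  node : BTree n → BTree n → BTree n

leaves : ∀ {n} → BTree n → List (Fin n)
leaves (leaf v) = v ∷ []
leaves (node l r) = leaves l ++ leaves r

IsDecompositionTree : ∀ {n} → BTree n → Set
IsDecompositionTree {n} t = leaves t ↭ allFin n

leafSet : ∀ {n} → BTree n → Subset n
leafSet {n} t = tabulate λ v → any (λ w → ⌊ w ≟ v ⌋) (leaves t)

-- subtrees other than the whole tree; each edge of the unrooted tree is
-- the edge above one of these (the two children of the root give the
-- same edge/cut)
properSubtrees : ∀ {n} → BTree n → List (BTree n)
properSubtrees (leaf v) = []
properSubtrees (node l r) = (l ∷ properSubtrees l) ++ (r ∷ properSubtrees r)

-- the decomposition tree t has boolean-width ≤ log₂ k, i.e. every cut
-- {A, Ā} of t has cut-bool(A) ≤ log₂ k and cut-bool(Ā) ≤ log₂ k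
HasBoolWidthAtMostLog : ∀ {n} → Graph n → BTree n → ℕ → Set
HasBoolWidthAtMostLog G t k =
  All (λ s → cutBoolCount G (leafSet s) ≤ k × cutBoolCount G (∁ (leafSet s)) ≤ k)
      (properSubtrees t)

-- boolw(G) ≤ log₂ k  (boolw is a minimum over decomposition trees)
BoolwAtMostLog : ∀ {n} → Graph n → ℕ → Set
BoolwAtMostLog {n} G k =
  Σ (BTree n) λ t → IsDecompositionTree t × HasBoolWidthAtMostLog G t k

module Submission where

-- For a cut {A, Ā} call the set Ā ∩ N(w) (empty when w ∉ A) the trace of w.
-- If the traces form a chain under inclusion and some vertex lies outside A,
-- then every union Ā ∩ N(X), X ⊆ A, is itself a trace, so at most n sets are
-- realized and cut-bool(A) ≤ log₂ n (the trace lemma, module Traces; the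
-- counting rests on a pigeonhole lemma for duplicate-free lists).  Chains of
-- traces arise when A is a singleton, when Ā is a singleton, and when
-- adjacency across the cut is a threshold in a nested family of relations.
--
-- In a permutation graph, sort the vertices v₁, …, vₙ by the position of
-- their segments on the upper line and take the caterpillar tree whose cuts
-- are {vᵢ} and {vᵢ, …, vₙ}.  Singleton cuts are bounded in any graph.  For a
-- suffix cut, a segment w of the suffix crosses a segment y of the prefix iff
-- w ends before y on the lower line, so both A and Ā have threshold adjacency
-- and the trace lemma bounds both sides (module PermutationGraph).

open import Defs hiding (sym)
open import Data.Nat using (ℕ; zero; suc; _≤_; z≤n; s≤s)
import Data.Nat.Properties as ℕ
open import Data.Bool using (Bool; true; false; _∧_; _∨_; not)
open import Data.Bool.Properties using (not-injective; ¬-not; ∨-comm; T-≡)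
open import Data.Bool.ListAction using (any)
open import Data.Fin as F using (Fin; _≟_)
import Data.Fin.Properties as FP
open import Data.Fin.Subset using (Subset; inside; outside; ∁; _∩_; _⊆_)
open import Data.Fin.Permutation using (Permutation′; _⟨$⟩ʳ_; _⟨$⟩ˡ_; inverseˡ)
open import Data.Vec using (_∷_; lookup; tabulate)
open import Data.Vec.Properties
  using (lookup-map; lookup-zipWith; lookup∘tabulate; tabulate∘lookup; tabulate-cong;
         []=⇒lookup; lookup⇒[]=; ∷-injectiveʳ)
open import Data.List using (List; []; _∷_; map; filter; length; allFin)
open import Data.List.Properties using (length-map; length-tabulate)
open import Data.List.Membership.Propositional using (_∈_; _∉_)
open import Data.List.Membership.Propositional.Properties
  using (∈-map⁺; ∈-map⁻; ∈-filter⁻; ∈-allFin)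
open import Data.List.Relation.Unary.Any as Any using (Any; here; there)
open import Data.List.Relation.Unary.Any.Properties using (any⁺; any⁻)
open import Data.List.Relation.Unary.All as All using (All; []; _∷_)
open import Data.List.Relation.Unary.AllPairs as AllPairs using (AllPairs; []; _∷_)
open import Data.List.Relation.Unary.Linked.Properties using (Linked⇒AllPairs)
open import Data.List.Relation.Unary.Unique.Propositional using (Unique)
import Data.List.Relation.Unary.Unique.Propositional.Properties as Unique
open import Data.List.Relation.Binary.Permutation.Propositional using (_↭_; ↭-sym; ↭⇒↭ₛ)
open import Data.List.Relation.Binary.Permutation.Propositional.Properties
  using (∈-resp-↭; ↭-length)
import Data.List.Relation.Binary.Permutation.Setoid.Properties as Permutationₛ
import Data.List.Sort as Sort
import Relation.Binary.Construct.On as On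
open import Data.Product using (Σ; _×_; _,_; proj₂)
open import Data.Sum as Sum using (_⊎_; inj₁; inj₂)
open import Data.Empty using (⊥)
open import Function.Base using (_∘_)
open import Function.Bundles using (_⇔_; mk⇔; Equivalence)
open import Function.Properties.Equivalence using () renaming (trans to ⇔-trans)
open import Relation.Binary.PropositionalEquality
  using (_≡_; _≢_; refl; sym; trans; cong; cong₂; subst; setoid)
open import Relation.Nullary using (¬_; yes; no; contradiction)
open import Relation.Nullary.Decidable using (toWitness; fromWitness)

module _ {a} {X : Set a} where

  remove : ∀ {x : X} {ys} → x ∈ ys → List X
  remove {ys = _ ∷ ys} (here _)  = ys
  remove {ys = y ∷ _}  (there p) = y ∷ remove p

  length-remove : ∀ {x : X} {ys} (p : x ∈ ys) → suc (length (remove p)) ≡ length ys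
  length-remove (here _)  = refl
  length-remove (there p) = cong suc (length-remove p)

  ∈-remove : ∀ {x z : X} {ys} (p : x ∈ ys) → z ∈ ys → z ≢ x → z ∈ remove p
  ∈-remove (here refl) (here refl) z≢x = contradiction refl z≢x
  ∈-remove (here refl) (there q)   _   = q
  ∈-remove (there p)   (here z≡y)  _   = here z≡y
  ∈-remove (there p)   (there q)   z≢x = there (∈-remove p q z≢x)

  unique⊆⇒length≤ : ∀ {xs ys : List X} → Unique xs →
                    (∀ {z} → z ∈ xs → z ∈ ys) → length xs ≤ length ys
  unique⊆⇒length≤ {[]}     _              _     = z≤n
  unique⊆⇒length≤ {x ∷ xs} {ys} (x∉xs ∷ uniq) xs⊆ys =
    subst (suc (length xs) ≤_) (length-remove x∈ys)
          (s≤s (unique⊆⇒length≤ uniq xs⊆ys-x))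
    where
      x∈ys : x ∈ ys
      x∈ys = xs⊆ys (here refl)
      xs⊆ys-x : ∀ {z} → z ∈ xs → z ∈ remove x∈ys
      xs⊆ys-x z∈xs =
        ∈-remove x∈ys (xs⊆ys (there z∈xs)) (λ z≡x → All.lookup x∉xs z∈xs (sym z≡x))

allSubsets-unique : ∀ n → Unique (allSubsets n)
allSubsets-unique zero    = [] ∷ []
allSubsets-unique (suc n) =
  Unique.++⁺ (Unique.map⁺ ∷-injectiveʳ (allSubsets-unique n))
             (Unique.map⁺ ∷-injectiveʳ (allSubsets-unique n))
             (λ (p , q) → disjoint p q)
  where
    disjoint : ∀ {S} → S ∈ map (outside ∷_) (allSubsets n) →
               S ∈ map (inside ∷_) (allSubsets n) → ⊥
    disjoint p q with ∈-map⁻ (outside ∷_) p | ∈-map⁻ (inside ∷_) q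
    ... | _ , _ , refl | _ , _ , ()

-- case split on a boolean without abstracting it in the goal
true-or-false : ∀ b → b ≡ true ⊎ b ≡ false
true-or-false true  = inj₁ refl
true-or-false false = inj₂ refl

∨-absorbs-stronger : ∀ {a b} → (a ≡ true → b ≡ true) → a ∨ b ≡ b
∨-absorbs-stronger {false} _   = refl
∨-absorbs-stronger {true}  a⇒b = sym (a⇒b refl)

∧-cong-guarded : ∀ a {b c} → (a ≡ true → b ≡ c) → a ∧ b ≡ a ∧ c
∧-cong-guarded false _   = refl
∧-cong-guarded true  b≡c = b≡c refl

lookup-∁ : ∀ {n} (A : Subset n) v → lookup (∁ A) v ≡ not (lookup A v)
lookup-∁ A v = lookup-map v not A

∉∁⇒∈ : ∀ {n} (A : Subset n) {v} → lookup (∁ A) v ≡ false → lookup A v ≡ true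
∉∁⇒∈ A {v} e = not-injective (trans (sym (lookup-∁ A v)) e)

∈∁⇒∉ : ∀ {n} (A : Subset n) {v} → lookup (∁ A) v ≡ true → lookup A v ≡ false
∈∁⇒∉ A {v} e = not-injective (trans (sym (lookup-∁ A v)) e)

∈⇒∉∁ : ∀ {n} (A : Subset n) {v} → lookup A v ≡ true → lookup (∁ A) v ≡ false
∈⇒∉∁ A {v} e = trans (lookup-∁ A v) (cong not e)

module Traces {n : ℕ} (G : Graph n) (A : Subset n) where

  crosses : Fin n → Fin n → Bool
  crosses w y = lookup A w ∧ adj G w y

  trace : Fin n → Subset n
  trace w = tabulate λ y → not (lookup A y) ∧ crosses w y

  _⊑_ : Fin n → Fin n → Set
  w ⊑ w' = ∀ y → lookup A y ≡ false → crosses w y ≡ true → crosses w' y ≡ true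

  IsChain : Set
  IsChain = ∀ w w' → w ⊑ w' ⊎ w' ⊑ w

  crosses-member : ∀ {w} y → lookup A w ≡ true → crosses w y ≡ adj G w y
  crosses-member y w∈A = cong (_∧ _) w∈A

  outside-⊑ : ∀ {w} w' → lookup A w ≡ false → w ⊑ w'
  outside-⊑ w' w∉A y _ w~y = contradiction (trans (sym (cong (_∧ _) w∉A)) w~y) λ ()

  chain-from-members :
    (∀ w w' → lookup A w ≡ true → lookup A w' ≡ true → w ⊑ w' ⊎ w' ⊑ w) → IsChain
  chain-from-members cmp w w' with true-or-false (lookup A w) | true-or-false (lookup A w')
  ... | inj₂ w∉A | _         = inj₁ (outside-⊑ w' w∉A)
  ... | inj₁ _   | inj₂ w'∉A = inj₂ (outside-⊑ w w'∉A)
  ... | inj₁ w∈A | inj₁ w'∈A = cmp w w' w∈A w'∈A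

  ⊑-join : ∀ {w w'} → w ⊑ w' → ∀ y → lookup A y ≡ false →
           crosses w y ∨ crosses w' y ≡ crosses w' y
  ⊑-join w⊑w' y y∉A = ∨-absorbs-stronger (w⊑w' y y∉A)

  join-is-trace : IsChain → ∀ w w' → Σ (Fin n) λ v → ∀ y → lookup A y ≡ false →
                  crosses w y ∨ crosses w' y ≡ crosses v y
  join-is-trace chain w w' with chain w w'
  ... | inj₁ w⊑w' = w' , ⊑-join w⊑w'
  ... | inj₂ w'⊑w = w , λ y y∉A → trans (∨-comm (crosses w y) _) (⊑-join w'⊑w y y∉A)

  ⊑-refl : ∀ {w} → w ⊑ w
  ⊑-refl _ _ w~y = w~y

  chain-if-singleton : ∀ v → (∀ w → lookup A w ≡ true → w ≡ v) → IsChain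
  chain-if-singleton v only-v = chain-from-members λ w w' w∈A w'∈A →
    inj₁ (subst (w ⊑_) (trans (only-v w w∈A) (sym (only-v w' w'∈A))) ⊑-refl)

  -- if Ā = {v}, every trace is ∅ or {v}
  chain-if-cosingleton : ∀ v → (∀ y → lookup A y ≡ false → y ≡ v) → IsChain
  chain-if-cosingleton v only-v w w' with true-or-false (crosses w' v)
  ... | inj₁ w'~v = inj₁ λ y y∉A _ →
        subst (λ u → crosses w' u ≡ true) (sym (only-v y y∉A)) w'~v
  ... | inj₂ w'≁v = inj₂ λ y y∉A w'~y →
        contradiction (trans (sym w'≁v) (subst (λ u → crosses w' u ≡ true) (only-v y y∉A) w'~y))
                      λ ()

  chain-if-threshold : (_≺_ : Fin n → Fin n → Set) →
    (∀ w y → lookup A w ≡ true → lookup A y ≡ false → adj G w y ≡ true ⇔ w ≺ y) →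
    (∀ w w' → (∀ y → w ≺ y → w' ≺ y) ⊎ (∀ y → w' ≺ y → w ≺ y)) → IsChain
  chain-if-threshold _≺_ adj⇔≺ nested = chain-from-members λ w w' w∈A w'∈A →
    Sum.map (⊑-from-≺ w∈A w'∈A) (⊑-from-≺ w'∈A w∈A) (nested w w')
    where
      ⊑-from-≺ : ∀ {w w'} → lookup A w ≡ true → lookup A w' ≡ true →
                 (∀ y → w ≺ y → w' ≺ y) → w ⊑ w'
      ⊑-from-≺ {w} {w'} w∈A w'∈A ≺-mono y y∉A w~y =
        trans (crosses-member y w'∈A)
          (Equivalence.from (adj⇔≺ w' y w'∈A y∉A)
            (≺-mono y (Equivalence.to (adj⇔≺ w y w∈A y∉A)
                        (trans (sym (crosses-member y w∈A)) w~y))))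

  -- b lies outside A, so its trace is the empty set; the traces form a chain
  module _ (b : Fin n) (b∉A : lookup A b ≡ false) (chain : IsChain) where

    -- The neighbourhood across the cut of the vertices of X occurring in xs
    -- is a single trace: the empty one (that of b), or the largest one.
    union-is-trace : (X : Subset n) → (∀ x → lookup X x ≡ true → lookup A x ≡ true) →
      ∀ xs → Σ (Fin n) λ w → ∀ y → lookup A y ≡ false →
             any (λ x → lookup X x ∧ adj G x y) xs ≡ crosses w y
    union-is-trace X X⊆A [] = b , λ y _ → cong (_∧ adj G b y) (sym b∉A)
    union-is-trace X X⊆A (x ∷ xs) with union-is-trace X X⊆A xs | lookup X x in x∈X
    ... | w , ih | false = w , ih
    ... | w , ih | true with join-is-trace chain x w
    ...   | v , join = v , λ y y∉A →
            trans (cong₂ _∨_ (sym (crosses-member y (X⊆A x x∈X))) (ih y y∉A)) (join y y∉A)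

    realized-is-trace : ∀ X → X ⊆ A → Σ (Fin n) λ w → ∁ A ∩ nbhd G X ≡ trace w
    realized-is-trace X X⊆A with union-is-trace X X⊆A′ (allFin n)
      where
        X⊆A′ : ∀ x → lookup X x ≡ true → lookup A x ≡ true
        X⊆A′ x e = []=⇒lookup (X⊆A (lookup⇒[]= x X e))
    ... | w , agree = w , trans (sym (tabulate∘lookup _)) (tabulate-cong pointwise)
      where
        pointwise : ∀ y → lookup (∁ A ∩ nbhd G X) y ≡ not (lookup A y) ∧ crosses w y
        pointwise y =
          trans (lookup-zipWith _∧_ y (∁ A) (nbhd G X))
            (trans (cong₂ _∧_ (lookup-∁ A y) (lookup∘tabulate _ y))
              (∧-cong-guarded (not (lookup A y)) λ y∉A → agree y (not-injective y∉A)))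

    cutBoolCount≤n : cutBoolCount G A ≤ n
    cutBoolCount≤n =
      subst (length realized ≤_) n-traces (unique⊆⇒length≤ realized-unique realized⊆traces)
      where
        realized : List (Subset n)
        realized = filter (realized? G A) (allSubsets n)
        realized-unique : Unique realized
        realized-unique = Unique.filter⁺ (realized? G A) {xs = allSubsets n} (allSubsets-unique n)
        n-traces : length (map trace (allFin n)) ≡ n
        n-traces = trans (length-map trace (allFin n)) (length-tabulate {n = n} (λ i → i))
        witness⇒trace : ∀ {S} {Xs} → Any (λ X → X ⊆ A × S ≡ ∁ A ∩ nbhd G X) Xs →
                        S ∈ map trace (allFin n)
        witness⇒trace (there p) = witness⇒trace p
        witness⇒trace (here {x = X} (X⊆A , S≡)) with realized-is-trace X X⊆A
        ... | w , ≡trace =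
          subst (_∈ map trace (allFin n)) (sym (trans S≡ ≡trace)) (∈-map⁺ trace (∈-allFin w))
        realized⊆traces : ∀ {S} → S ∈ realized → S ∈ map trace (allFin n)
        realized⊆traces S∈ =
          witness⇒trace (proj₂ (∈-filter⁻ (realized? G A) {xs = allSubsets n} S∈))

CutBounded : ∀ {n} → Graph n → Subset n → Set
CutBounded {n} G A = cutBoolCount G A ≤ n × cutBoolCount G (∁ A) ≤ n

singleton-cut-bounded : ∀ {n} (G : Graph n) (A : Subset n) x y →
  (∀ v → lookup A v ≡ true ⇔ v ≡ x) → y ≢ x → CutBounded G A
singleton-cut-bounded G A x y A≡[x] y≢x =
  Traces.cutBoolCount≤n G A y y∉A
    (Traces.chain-if-singleton G A x λ v → Equivalence.to (A≡[x] v)) ,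
  Traces.cutBoolCount≤n G (∁ A) x (∈⇒∉∁ A (Equivalence.from (A≡[x] x) refl))
    (Traces.chain-if-cosingleton G (∁ A) x λ v v∉Ā → Equivalence.to (A≡[x] v) (∉∁⇒∈ A v∉Ā))
  where
    y∉A : lookup A y ≡ false
    y∉A = ¬-not (y≢x ∘ Equivalence.to (A≡[x] y))

leafSet-member : ∀ {n} (t : BTree n) v → lookup (leafSet t) v ≡ true ⇔ v ∈ leaves t
leafSet-member t v = mk⇔ to from
  where
    to : lookup (leafSet t) v ≡ true → v ∈ leaves t
    to e = Any.map (λ w≟v → sym (toWitness w≟v))
             (any⁻ _ (leaves t) (Equivalence.from T-≡ (trans (sym (lookup∘tabulate _ v)) e)))
    from : v ∈ leaves t → lookup (leafSet t) v ≡ true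
    from m = trans (lookup∘tabulate _ v)
               (Equivalence.to T-≡ (any⁺ _ (Any.map (λ v≡w → fromWitness (sym v≡w)) m)))

false⇔¬ : ∀ {b} {P : Set} → (b ≡ true ⇔ P) → b ≡ false ⇔ (¬ P)
false⇔¬ b⇔P = mk⇔
  (λ b≡false p → contradiction (trans (sym b≡false) (Equivalence.from b⇔P p)) λ ())
  (λ ¬p → ¬-not (¬p ∘ Equivalence.to b⇔P))

-- the caterpillar whose leaves, read from left to right, are x ∷ xs; its
-- proper subtrees are the single leaves and the suffixes of x ∷ xs
caterpillar : ∀ {n} → Fin n → List (Fin n) → BTree n
caterpillar x []       = leaf x
caterpillar x (y ∷ ys) = node (leaf x) (caterpillar y ys)

leaves-caterpillar : ∀ {n} (x : Fin n) xs → leaves (caterpillar x xs) ≡ x ∷ xs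
leaves-caterpillar x []       = refl
leaves-caterpillar x (y ∷ ys) = cong (x ∷_) (leaves-caterpillar y ys)

caterpillar-member : ∀ {n} (x : Fin n) xs v →
  lookup (leafSet (caterpillar x xs)) v ≡ true ⇔ v ∈ x ∷ xs
caterpillar-member x xs v =
  subst (λ ls → lookup (leafSet (caterpillar x xs)) v ≡ true ⇔ v ∈ ls)
        (leaves-caterpillar x xs) (leafSet-member (caterpillar x xs) v)

leaf-member : ∀ {n} (x v : Fin n) → lookup (leafSet (leaf x)) v ≡ true ⇔ v ≡ x
leaf-member x v = mk⇔ (λ e → singleton (Equivalence.to (leafSet-member (leaf x) v) e))
                      (λ v≡x → Equivalence.from (leafSet-member (leaf x) v) (here v≡x))
  where
    singleton : v ∈ x ∷ [] → v ≡ x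
    singleton (here v≡x) = v≡x

crossing-when-before : ∀ {n} (f g : Fin n → Fin n) {u v} → f u F.< f v →
                       Crossing f g u v ⇔ g v F.< g u
crossing-when-before f g {u} {v} fu<fv = mk⇔ to (λ gv<gu → inj₁ (fu<fv , gv<gu))
  where
    to : Crossing f g u v → g v F.< g u
    to (inj₁ (_ , gv<gu))  = gv<gu
    to (inj₂ (fv<fu , _)) = contradiction fu<fv (FP.<-asym fv<fu)

above-nested : ∀ {n m} (κ : Fin n → Fin m) w w' →
  (∀ y → κ w F.< κ y → κ w' F.< κ y) ⊎ (∀ y → κ w' F.< κ y → κ w F.< κ y)
above-nested κ w w' with FP.≤-total (κ w) (κ w')
... | inj₁ κw≤κw' = inj₂ λ y → ℕ.≤-<-trans κw≤κw'
... | inj₂ κw'≤κw = inj₁ λ y → ℕ.≤-<-trans κw'≤κw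

below-nested : ∀ {n m} (κ : Fin n → Fin m) w w' →
  (∀ y → κ y F.< κ w → κ y F.< κ w') ⊎ (∀ y → κ y F.< κ w' → κ y F.< κ w)
below-nested κ w w' with FP.≤-total (κ w) (κ w')
... | inj₁ κw≤κw' = inj₁ λ y κy<κw → ℕ.<-≤-trans κy<κw κw≤κw'
... | inj₂ κw'≤κw = inj₂ λ y κy<κw' → ℕ.<-≤-trans κy<κw' κw'≤κw

module PermutationGraph {n : ℕ} (G : Graph n) (top bot : Permutation′ n)
  (model : ∀ u v → (adj G u v ≡ true) ⇔ Crossing (top ⟨$⟩ʳ_) (bot ⟨$⟩ʳ_) u v) where

  tp bt : Fin n → Fin n
  tp = top ⟨$⟩ʳ_
  bt = bot ⟨$⟩ʳ_

  Before : Fin n → Fin n → Set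
  Before u v = tp u F.< tp v

  tp-injective : ∀ {u v} → tp u ≡ tp v → u ≡ v
  tp-injective e =
    trans (sym (inverseˡ top)) (trans (cong (top ⟨$⟩ˡ_) e) (inverseˡ top))

  adjacent-when-before : ∀ {y w} → Before y w → adj G y w ≡ true ⇔ bt w F.< bt y
  adjacent-when-before {y} {w} y<w = ⇔-trans (model y w) (crossing-when-before tp bt y<w)

  adjacent-sym : ∀ {u v} → adj G u v ≡ true ⇔ adj G v u ≡ true
  adjacent-sym {u} {v} = mk⇔ (trans (Graph.sym G v u)) (trans (Graph.sym G u v))

  IsUpperCut : Subset n → Set
  IsUpperCut A = ∀ y w → lookup A y ≡ false → lookup A w ≡ true → Before y w

  -- both sides of such a cut have threshold adjacency, ordered by the lower line
  upper-cut-bounded : ∀ A → IsUpperCut A → ∀ a b →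
    lookup A a ≡ true → lookup A b ≡ false → CutBounded G A
  upper-cut-bounded A upper a b a∈A b∉A =
    Traces.cutBoolCount≤n G A b b∉A
      (Traces.chain-if-threshold G A (λ w y → bt w F.< bt y)
        (λ w y w∈A y∉A → ⇔-trans adjacent-sym (adjacent-when-before (upper y w y∉A w∈A)))
        (above-nested bt)) ,
    Traces.cutBoolCount≤n G (∁ A) a (∈⇒∉∁ A a∈A)
      (Traces.chain-if-threshold G (∁ A) (λ y w → bt w F.< bt y)
        (λ y w y∈Ā w∉Ā → adjacent-when-before (upper y w (∈∁⇒∉ A y∈Ā) (∉∁⇒∈ A w∉Ā)))
        (below-nested bt))

  IsFinalSegment : List (Fin n) → Set
  IsFinalSegment s = ∀ y w → y ∉ s → w ∈ s → Before y w

  -- Every cut of the caterpillar of a sorted final segment is bounded: the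
  -- single leaf x by the singleton lemma, the suffix after x as an upper cut.
  caterpillar-cuts-bounded : ∀ x xs → AllPairs Before (x ∷ xs) → IsFinalSegment (x ∷ xs) →
    All (λ s → CutBounded G (leafSet s)) (properSubtrees (caterpillar x xs))
  caterpillar-cuts-bounded x [] _ _ = []
  caterpillar-cuts-bounded x (y ∷ ys) (x-first ∷ sorted) final =
    singleton-cut-bounded G _ x y (leaf-member x) y≢x ∷
    upper-cut-bounded (leafSet (caterpillar y ys)) upper y x
      (Equivalence.from (suffix-member y) (here refl))
      (Equivalence.from (false⇔¬ (suffix-member x)) x∉suffix) ∷
    caterpillar-cuts-bounded y ys sorted final′
    where
      suffix-member : ∀ v → lookup (leafSet (caterpillar y ys)) v ≡ true ⇔ v ∈ y ∷ ys
      suffix-member = caterpillar-member y ys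
      x∉suffix : x ∉ y ∷ ys
      x∉suffix x∈ = FP.<-irrefl refl (All.lookup x-first x∈)
      y≢x : y ≢ x
      y≢x y≡x = x∉suffix (here (sym y≡x))
      final′ : IsFinalSegment (y ∷ ys)
      final′ z w z∉ w∈ with z ≟ x
      ... | yes refl = All.lookup x-first w∈
      ... | no z≢x   =
        final z w (λ { (here z≡x) → z≢x z≡x ; (there z∈) → z∉ z∈ }) (there w∈)
      upper : IsUpperCut (leafSet (caterpillar y ys))
      upper z w z∉A w∈A = final′ z w (Equivalence.to (false⇔¬ (suffix-member z)) z∉A)
                                     (Equivalence.to (suffix-member w) w∈A)

  sorted-vertices : Σ (List (Fin n)) λ order → order ↭ allFin n × AllPairs Before order
  sorted-vertices = order , perm , AllPairs.map strict (AllPairs.zip (weakly , distinct))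
    where
      open Sort (On.decTotalOrder (FP.≤-decTotalOrder n) tp) using (sort; sort-↭; sort-↗)
      order : List (Fin n)
      order = sort (allFin n)
      perm : order ↭ allFin n
      perm = sort-↭ (allFin n)
      weakly : AllPairs (λ u v → tp u F.≤ tp v) order
      weakly = Linked⇒AllPairs FP.≤-trans (sort-↗ (allFin n))
      distinct : Unique order
      distinct =
        Permutationₛ.Unique-resp-↭ (setoid (Fin n)) (↭⇒↭ₛ (↭-sym perm)) (Unique.allFin⁺ n)
      strict : ∀ {u v} → tp u F.≤ tp v × u ≢ v → Before u v
      strict (tpu≤tpv , u≢v) = FP.≤∧≢⇒< tpu≤tpv (u≢v ∘ tp-injective)

  caterpillar-decomposition : 1 ≤ n → (order : List (Fin n)) → order ↭ allFin n →
    AllPairs Before order → BoolwAtMostLog G n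
  caterpillar-decomposition 1≤n [] perm _ = contradiction (subst (1 ≤_) (sym n≡0) 1≤n) λ ()
    where
      n≡0 : 0 ≡ n
      n≡0 = trans (↭-length perm) (length-tabulate {n = n} (λ i → i))
  caterpillar-decomposition _ (x ∷ xs) perm sorted =
    caterpillar x xs ,
    subst (_↭ allFin n) (sym (leaves-caterpillar x xs)) perm ,
    caterpillar-cuts-bounded x xs sorted everything-final
    where
      everything-final : IsFinalSegment (x ∷ xs)
      everything-final y _ y∉ _ = contradiction (∈-resp-↭ (↭-sym perm) (∈-allFin y)) y∉

mainTheorem1 : (n : ℕ) → 1 ≤ n → (G : Graph n) → IsPermutationGraph G →
    BoolwAtMostLog G n
mainTheorem1 n 1≤n G (top , bot , model) =
  let open PermutationGraph G top bot model
      (order , perm , sorted) = sorted-vertices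
  in caterpillar-decomposition 1≤n order perm sorted
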